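{- Let $G$ be a graph without isolated vertices and let $S$ be a guarded and valid assignment. Then $Pr(\mathbf{Ext}(S)) = 2^{ -(|S_V|+|Free(S)\cap Var(S_E)|)}$.
   Context: $\psi(G)$ is the CNF with variable set $V(G)\cup E(G)$ and, for each edge $e=\{u,v\}$, the clause $(u\vee e\vee v)$. An assignment is a set of literals without a variable together with its negation; here assignments have variables in $V(G)\cup E(G)$, and $S=S_V\cup S_E$ where $S_V$ (resp. $S_E$) consists of the literals of vertex (resp. edge) variables. $\mathbf{SAT}(G)$ is the set of satisfying assignments of $\psi(G)$ over all of $V(G)\cup E(G)$. The space $\mathcal{VE}(G)$ has universe $\mathbf{SAT}(G)$ with $Pr(S^*)=2^{ -(|V(G)|+|F(S^*)|)}$, where $F(S^*)$ is the set of edges $\{u,v\}$ with $u$ or $v$ positive in $S^*$; probabilities of sets are sums. $\mathbf{Ext}(S)$ is the set of $S^*\in\mathbf{SAT}(G)$ with $S\subseteq S^*$. An edge $\{u,v\}$ is guarded by $S$ if $u,v\in Var(S_V)$; it is enforced by $S$ if both $u$ and $v$ occur negatively in $S_V$, and free otherwise; $Free(S)$ and $Enforced(S)$ denote the sets of free and enforced edges. $S$ is guarded if every edge variable in $Var(S_E)$ is guarded by $S$, and valid if every edge variable in $Var(S_E)\cap Enforced(S)$ occurs positively in $S$. -}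

module Defs where

open import Data.Nat using (ℕ; zero; suc; _+_; _^_)
open import Data.Nat.Properties using (m^n≢0)
open import Data.Fin using (Fin; zero; suc; _≟_)
open import Data.Bool using (Bool; true; false; _∨_; _∧_; not; if_then_else_)
open import Data.Maybe using (Maybe; just; nothing; is-just)
open import Data.Product using (_×_; _,_; proj₁; proj₂; ∃)
open import Data.Sum using (_⊎_)
open import Data.List using (List; []; _∷_; _++_; map; concatMap)
open import Data.Integer using (+_)
open import Data.Rational using (ℚ; _/_; 0ℚ; _+_)
open import Relation.Binary.PropositionalEquality using (_≡_; _≢_)
open import Relation.Nullary.Decidable using (⌊_⌋)

SameEnds : ∀ {n} → Fin n × Fin n → Fin n × Fin n → Set
SameEnds (a , b) (c , d) = (a ≡ c × b ≡ d) ⊎ (a ≡ d × b ≡ c)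

record Graph : Set where
  field
    nV       : ℕ
    nE       : ℕ
    ends     : Fin nE → Fin nV × Fin nV
    loopless : ∀ e → proj₁ (ends e) ≢ proj₂ (ends e)
    simple   : ∀ e f → SameEnds (ends e) (ends f) → e ≡ f

open Graph public

src tgt : (G : Graph) → Fin (nE G) → Fin (nV G)
src G e = proj₁ (ends G e)
tgt G e = proj₂ (ends G e)

NoIsolatedVertices : Graph → Set
NoIsolatedVertices G = ∀ v → ∃ λ e → (src G e ≡ v) ⊎ (tgt G e ≡ v)

-- (Partial) assignments on V(G) ∪ E(G): a consistent set of literals is a
-- partial map variable ↦ Bool (just true = positive literal,
-- just false = negative literal, nothing = variable absent).

record Assignment (G : Graph) : Set where
  field
    SV : Fin (nV G) → Maybe Bool
    SE : Fin (nE G) → Maybe Bool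

open Assignment public

record Total (G : Graph) : Set where
  field
    τV : Fin (nV G) → Bool
    τE : Fin (nE G) → Bool

open Total public

Guarded : ∀ {G} → Assignment G → Set
Guarded {G} S = ∀ e b → SE S e ≡ just b →
  (∃ λ b₁ → SV S (src G e) ≡ just b₁) × (∃ λ b₂ → SV S (tgt G e) ≡ just b₂)

enforced : ∀ {G} → Assignment G → Fin (nE G) → Bool
enforced {G} S e = isFalse (SV S (src G e)) ∧ isFalse (SV S (tgt G e))
  where
  isFalse : Maybe Bool → Bool
  isFalse (just false) = true
  isFalse _            = false

Valid : ∀ {G} → Assignment G → Set
Valid {G} S = ∀ e b → SE S e ≡ just b → enforced S e ≡ true → b ≡ true

countFin : (k : ℕ) → (Fin k → Bool) → ℕ
countFin zero    p = 0
countFin (suc k) p = (if p zero then 1 else 0) Data.Nat.+ countFin k (λ i → p (suc i))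

allFin : (k : ℕ) → (Fin k → Bool) → Bool
allFin zero    p = true
allFin (suc k) p = p zero ∧ allFin k (λ i → p (suc i))

-- all functions Fin k → Bool, each exactly once
allFns : (k : ℕ) → List (Fin k → Bool)
allFns zero    = (λ ()) ∷ []
allFns (suc k) = concatMap (λ f → cons false f ∷ cons true f ∷ []) (allFns k)
  where
  cons : Bool → (Fin k → Bool) → Fin (suc k) → Bool
  cons b f zero    = b
  cons b f (suc i) = f i

allTotals : (G : Graph) → List (Total G)
allTotals G = concatMap (λ fV → map (λ fE → record { τV = fV ; τE = fE }) (allFns (nE G)))
                        (allFns (nV G))

sumℚ : List ℚ → ℚ
sumℚ []       = 0ℚ
sumℚ (x ∷ xs) = x Data.Rational.+ sumℚ xs

pow2inv : ℕ → ℚ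
pow2inv k = _/_ (+ 1) (2 ^ k) {{m^n≢0 2 k}}

satisfies : ∀ {G} → Total G → Bool
satisfies {G} τ = allFin (nE G) (λ e → τV τ (src G e) ∨ τE τ e ∨ τV τ (tgt G e))

agrees : Maybe Bool → Bool → Bool
agrees nothing      _     = true
agrees (just true)  b     = b
agrees (just false) b     = not b

extends : ∀ {G} → Assignment G → Total G → Bool
extends {G} S τ =
  allFin (nV G) (λ v → agrees (SV S v) (τV τ v)) ∧
  allFin (nE G) (λ e → agrees (SE S e) (τE τ e))

numF : ∀ {G} → Total G → ℕ
numF {G} τ = countFin (nE G) (λ e → τV τ (src G e) ∨ τV τ (tgt G e))

PrPoint : ∀ {G} → Total G → ℚ
PrPoint {G} τ = pow2inv (nV G Data.Nat.+ numF τ)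

PrExt : ∀ {G} → Assignment G → ℚ
PrExt {G} S = sumℚ (map (λ τ → if satisfies τ ∧ extends S τ then PrPoint τ else 0ℚ)
                        (allTotals G))

sizeSV : ∀ {G} → Assignment G → ℕ
sizeSV {G} S = countFin (nV G) (λ v → is-just (SV S v))

numFreeAssignedEdges : ∀ {G} → Assignment G → ℕ
numFreeAssignedEdges {G} S = countFin (nE G) (λ e → is-just (SE S e) ∧ not (enforced S e))

-- Write Pr(S*) · [S* ∈ SAT(G), S ⊆ S*] as 2^{-|V|} · ∏_v [S*_v agrees with S]
-- · ∏_e (clause e satisfied) · [S*_e agrees with S] · 2^{-[e ∈ F(S*)]}.
-- Summing over the edge values first, each edge contributes a factor
-- depending only on its endpoints. For S*_V ⊇ S_V this factor is 1 for an
-- edge outside Var(S_E) (both values, ½ each, if an endpoint is true; only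
-- e = true otherwise), ½ for a free edge of Var(S_E) (guardedness fixes its
-- endpoints), and 1 for an enforced one (validity makes its literal
-- positive). So the edge sum is 2^{-|Free(S) ∩ Var(S_E)|} independently of
-- S*_V, and the remaining vertex sum is ∏_v ½ · #{values agreeing with S}
-- = 2^{-|S_V|}.
module Submission where

open import Defs
open import Relation.Binary.PropositionalEquality using (_≡_)
open import Data.Nat using (_+_)

open import Relation.Binary.PropositionalEquality
  using (refl; sym; trans; cong; cong₂; module ≡-Reasoning)
open import Function using (_∘_)
open import Data.Nat as ℕ using (zero; suc; NonZero)
open import Data.Nat.Properties using (m*n≢0; m^n≢0)
open import Data.Fin using (Fin; zero; suc)
open import Data.Bool using (Bool; true; false; _∨_; _∧_; not; if_then_else_)
open import Data.Maybe using (Maybe; just; nothing; is-just)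
open import Data.Product using (_,_)
open import Data.List using (List; []; _∷_; _++_; map; concatMap)
open import Data.List.Properties using (map-++; map-∘)
open import Data.Integer using (+_)
open import Data.Rational as ℚ using (ℚ; 0ℚ; 1ℚ; ½; _*_; _/_; toℚᵘ)
import Data.Rational.Properties as ℚₚ
import Data.Rational.Unnormalised as ℚᵘ
import Data.Rational.Unnormalised.Properties as ℚᵘₚ
open import Algebra.Bundles using (CommutativeMonoid)
open import Algebra.Properties.CommutativeMonoid.Sum ℚₚ.*-1-commutativeMonoid
  using () renaming (sum to ∏; ∑-distrib-+ to ∏-distrib-*; sum-cong-≗ to ∏-cong)
open import Algebra.Properties.CommutativeSemigroup
  (CommutativeMonoid.commutativeSemigroup ℚₚ.*-1-commutativeMonoid)
  using (interchange; x∙yz≈y∙xz; xy∙z≈yz∙x; xy∙z≈xz∙y)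

1/[2*n]≡½*1/n : ∀ n .{{_ : NonZero n}} →
  (+ 1 / (2 ℕ.* n)) {{m*n≢0 2 n}} ≡ ½ * (+ 1 / n)
-- Here + 1 / suc d unfolds to fromℚᵘ (mkℚᵘ (+ 1) d), and 2 ℕ.* suc d to
-- suc (d ℕ.+ suc (d ℕ.+ 0)).
1/[2*n]≡½*1/n (suc d) = ℚₚ.toℚᵘ-injective (begin
  toℚᵘ (+ 1 / (2 ℕ.* suc d))          ≈⟨ ℚₚ.toℚᵘ-fromℚᵘ (ℚᵘ.mkℚᵘ (+ 1) (d ℕ.+ suc (d ℕ.+ 0))) ⟩
  ℚᵘ.mkℚᵘ (+ 1) (d ℕ.+ suc (d ℕ.+ 0)) ≈⟨ ℚᵘₚ.*-congˡ {toℚᵘ ½} (ℚₚ.toℚᵘ-fromℚᵘ (ℚᵘ.mkℚᵘ (+ 1) d)) ⟨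
  toℚᵘ ½ ℚᵘ.* toℚᵘ (+ 1 / suc d)      ≈⟨ ℚₚ.toℚᵘ-homo-* ½ (+ 1 / suc d) ⟨
  toℚᵘ (½ * (+ 1 / suc d))            ∎)
  where open ℚᵘₚ.≃-Reasoning

pow2inv-suc : ∀ k → pow2inv (suc k) ≡ ½ * pow2inv k
pow2inv-suc k = 1/[2*n]≡½*1/n (2 ℕ.^ k) {{m^n≢0 2 k}}

pow2inv-+ : ∀ a b → pow2inv (a + b) ≡ pow2inv a * pow2inv b
pow2inv-+ zero    b = sym (ℚₚ.*-identityˡ (pow2inv b))
pow2inv-+ (suc a) b = begin
  pow2inv (suc a + b)          ≡⟨ pow2inv-suc (a + b) ⟩
  ½ * pow2inv (a + b)          ≡⟨ cong (½ *_) (pow2inv-+ a b) ⟩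
  ½ * (pow2inv a * pow2inv b)  ≡⟨ ℚₚ.*-assoc ½ (pow2inv a) (pow2inv b) ⟨
  ½ * pow2inv a * pow2inv b    ≡⟨ cong (_* pow2inv b) (pow2inv-suc a) ⟨
  pow2inv (suc a) * pow2inv b  ∎
  where open ≡-Reasoning

pow2inv≡∏½ : ∀ k → pow2inv k ≡ ∏ {k} (λ _ → ½)
pow2inv≡∏½ zero    = refl
pow2inv≡∏½ (suc k) = trans (pow2inv-suc k) (cong (½ *_) (pow2inv≡∏½ k))

½^_ : Bool → ℚ
½^ true  = ½
½^ false = 1ℚ

pow2inv-countFin : ∀ k (p : Fin k → Bool) → pow2inv (countFin k p) ≡ ∏ (½^_ ∘ p)
pow2inv-countFin zero    p = refl
pow2inv-countFin (suc k) p with p zero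
... | true  = trans (pow2inv-suc (countFin k (p ∘ suc))) (cong (½ *_) (pow2inv-countFin k (p ∘ suc)))
... | false = trans (pow2inv-countFin k (p ∘ suc)) (sym (ℚₚ.*-identityˡ _))

𝟙 : Bool → ℚ
𝟙 true  = 1ℚ
𝟙 false = 0ℚ

𝟙-∧ : ∀ a b → 𝟙 (a ∧ b) ≡ 𝟙 a * 𝟙 b
𝟙-∧ true  b = sym (ℚₚ.*-identityˡ (𝟙 b))
𝟙-∧ false b = sym (ℚₚ.*-zeroˡ (𝟙 b))

𝟙-allFin : ∀ k (p : Fin k → Bool) → 𝟙 (allFin k p) ≡ ∏ (𝟙 ∘ p)
𝟙-allFin zero    p = refl
𝟙-allFin (suc k) p = trans (𝟙-∧ (p zero) _) (cong (𝟙 (p zero) *_) (𝟙-allFin k (p ∘ suc)))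

if-then-0≡𝟙* : ∀ b x → (if b then x else 0ℚ) ≡ 𝟙 b * x
if-then-0≡𝟙* true  x = sym (ℚₚ.*-identityˡ x)
if-then-0≡𝟙* false x = sym (ℚₚ.*-zeroˡ x)

𝟙*-cong : ∀ b x {y z} → (b ≡ true → y ≡ z) → 𝟙 b * x * y ≡ 𝟙 b * x * z
𝟙*-cong true  x y≡z = cong (1ℚ * x *_) (y≡z refl)
𝟙*-cong false x {y} {z} _ = begin
  0ℚ * x * y  ≡⟨ cong (_* y) (ℚₚ.*-zeroˡ x) ⟩
  0ℚ * y      ≡⟨ ℚₚ.*-zeroˡ y ⟩
  0ℚ          ≡⟨ ℚₚ.*-zeroˡ z ⟨
  0ℚ * z      ≡⟨ cong (_* z) (ℚₚ.*-zeroˡ x) ⟨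
  0ℚ * x * z  ∎
  where open ≡-Reasoning

allFin⇒ : ∀ k (p : Fin k → Bool) → allFin k p ≡ true → ∀ i → p i ≡ true
allFin⇒ (suc k) p all i with p zero in p₀
allFin⇒ (suc k) p all zero    | true = p₀
allFin⇒ (suc k) p all (suc i) | true = allFin⇒ k (p ∘ suc) all i

sumℚ-map-cong : ∀ {A : Set} {f g : A → ℚ} → (∀ x → f x ≡ g x) →
  ∀ xs → sumℚ (map f xs) ≡ sumℚ (map g xs)
sumℚ-map-cong f≗g []       = refl
sumℚ-map-cong f≗g (x ∷ xs) = cong₂ ℚ._+_ (f≗g x) (sumℚ-map-cong f≗g xs)

sumℚ-++ : ∀ xs ys → sumℚ (xs ++ ys) ≡ sumℚ xs ℚ.+ sumℚ ys
sumℚ-++ []       ys = sym (ℚₚ.+-identityˡ (sumℚ ys))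
sumℚ-++ (x ∷ xs) ys =
  trans (cong (x ℚ.+_) (sumℚ-++ xs ys)) (sym (ℚₚ.+-assoc x (sumℚ xs) (sumℚ ys)))

sumℚ-concatMap : ∀ {A B : Set} (f : B → ℚ) (h : A → List B) xs →
  sumℚ (map f (concatMap h xs)) ≡ sumℚ (map (λ x → sumℚ (map f (h x))) xs)
sumℚ-concatMap f h []       = refl
sumℚ-concatMap f h (x ∷ xs) = begin
  sumℚ (map f (h x ++ concatMap h xs))            ≡⟨ cong sumℚ (map-++ f (h x) _) ⟩
  sumℚ (map f (h x) ++ map f (concatMap h xs))    ≡⟨ sumℚ-++ (map f (h x)) _ ⟩
  sumℚ (map f (h x)) ℚ.+ sumℚ (map f (concatMap h xs))
    ≡⟨ cong (sumℚ (map f (h x)) ℚ.+_) (sumℚ-concatMap f h xs) ⟩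
  sumℚ (map f (h x)) ℚ.+ sumℚ (map (λ x → sumℚ (map f (h x))) xs) ∎
  where open ≡-Reasoning

sumℚ-*ˡ : ∀ {A : Set} c (f : A → ℚ) xs → sumℚ (map (λ x → c * f x) xs) ≡ c * sumℚ (map f xs)
sumℚ-*ˡ c f []       = sym (ℚₚ.*-zeroʳ c)
sumℚ-*ˡ c f (x ∷ xs) = trans (cong (c * f x ℚ.+_) (sumℚ-*ˡ c f xs))
                             (sym (ℚₚ.*-distribˡ-+ c (f x) (sumℚ (map f xs))))

sumℚ-allFns-∏ : ∀ k (g : Fin k → Bool → ℚ) →
  sumℚ (map (λ f → ∏ (λ i → g i (f i))) (allFns k)) ≡ ∏ (λ i → g i false ℚ.+ g i true)
sumℚ-allFns-∏ zero    g = refl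
sumℚ-allFns-∏ (suc k) g = begin
  sumℚ (map (λ f → ∏ (λ i → g i (f i))) (allFns (suc k)))
    ≡⟨ sumℚ-concatMap (λ f → ∏ (λ i → g i (f i))) _ (allFns k) ⟩
  sumℚ (map (λ f → g₀ false * P f ℚ.+ (g₀ true * P f ℚ.+ 0ℚ)) (allFns k))
    ≡⟨ sumℚ-map-cong factor-g₀ (allFns k) ⟩
  sumℚ (map (λ f → (g₀ false ℚ.+ g₀ true) * P f) (allFns k))
    ≡⟨ sumℚ-*ˡ (g₀ false ℚ.+ g₀ true) P (allFns k) ⟩
  (g₀ false ℚ.+ g₀ true) * sumℚ (map P (allFns k))
    ≡⟨ cong ((g₀ false ℚ.+ g₀ true) *_) (sumℚ-allFns-∏ k (g ∘ suc)) ⟩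
  ∏ (λ i → g i false ℚ.+ g i true) ∎
  where
  open ≡-Reasoning
  g₀ : Bool → ℚ
  g₀ = g zero
  P : (Fin k → Bool) → ℚ
  P f = ∏ (λ i → g (suc i) (f i))
  factor-g₀ : ∀ f → g₀ false * P f ℚ.+ (g₀ true * P f ℚ.+ 0ℚ) ≡ (g₀ false ℚ.+ g₀ true) * P f
  factor-g₀ f = trans (cong (g₀ false * P f ℚ.+_) (ℚₚ.+-identityʳ (g₀ true * P f)))
                      (sym (ℚₚ.*-distribʳ-+ (P f) (g₀ false) (g₀ true)))

-- The contribution of an edge with endpoint values s, t, S-literal m (if any)
-- and value b in S*: clause indicator, agreement with S, and its share of
-- the weight 2^{-|F(S*)|}.
edgeWeight : Bool → Bool → Maybe Bool → Bool → ℚ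
edgeWeight s t m b = 𝟙 (s ∨ b ∨ t) * 𝟙 (agrees m b) * ½^ (s ∨ t)

edgeWeight-nothing : ∀ s t → edgeWeight s t nothing false ℚ.+ edgeWeight s t nothing true ≡ 1ℚ
edgeWeight-nothing true  true  = refl
edgeWeight-nothing true  false = refl
edgeWeight-nothing false true  = refl
edgeWeight-nothing false false = refl

edgeWeight-just : ∀ s t b → (not s ∧ not t ≡ true → b ≡ true) →
  edgeWeight s t (just b) false ℚ.+ edgeWeight s t (just b) true ≡ ½^ (not (not s ∧ not t))
edgeWeight-just true  true  true  _     = refl
edgeWeight-just true  true  false _     = refl
edgeWeight-just true  false true  _     = refl
edgeWeight-just true  false false _     = refl
edgeWeight-just false true  true  _     = refl
edgeWeight-just false true  false _     = refl
edgeWeight-just false false true  _     = refl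
edgeWeight-just false false false enforced⇒true with () ← enforced⇒true refl

½*agreements : ∀ m → ½ * (𝟙 (agrees m false) ℚ.+ 𝟙 (agrees m true)) ≡ ½^ (is-just m)
½*agreements nothing      = refl
½*agreements (just true)  = refl
½*agreements (just false) = refl

agrees-just : ∀ {m x b} → m ≡ just b → agrees m x ≡ true → x ≡ b
agrees-just {x = true}  {true}  refl _ = refl
agrees-just {x = false} {false} refl _ = refl

enforced-just : ∀ {G} (S : Assignment G) e {b₁ b₂} →
  SV S (src G e) ≡ just b₁ → SV S (tgt G e) ≡ just b₂ → enforced S e ≡ not b₁ ∧ not b₂
enforced-just S e {true}          p₁ p₂ rewrite p₁ = refl
enforced-just S e {false} {true}  p₁ p₂ rewrite p₁ | p₂ = refl
enforced-just S e {false} {false} p₁ p₂ rewrite p₁ | p₂ = refl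

total : ∀ {G} → (Fin (nV G) → Bool) → (Fin (nE G) → Bool) → Total G
total fV fE = record { τV = fV ; τE = fE }

sumℚ-allTotals : ∀ G (h : Total G → ℚ) → sumℚ (map h (allTotals G)) ≡
  sumℚ (map (λ fV → sumℚ (map (λ fE → h (total fV fE)) (allFns (nE G)))) (allFns (nV G)))
sumℚ-allTotals G h =
  trans (sumℚ-concatMap h (λ fV → map (total fV) (allFns (nE G))) (allFns (nV G)))
        (sumℚ-map-cong (λ fV → cong sumℚ (sym (map-∘ (allFns (nE G))))) (allFns (nV G)))

module _ {G : Graph} (S : Assignment G) where

  weight : Total G → ℚ
  weight τ = if satisfies τ ∧ extends S τ then PrPoint τ else 0ℚ

  extendsV : (Fin (nV G) → Bool) → Bool
  extendsV fV = allFin (nV G) (λ v → agrees (SV S v) (fV v))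

  edgeWeightAt : (Fin (nV G) → Bool) → Fin (nE G) → Bool → ℚ
  edgeWeightAt fV e = edgeWeight (fV (src G e)) (fV (tgt G e)) (SE S e)

  weight-factorises : ∀ fV fE →
    weight (total fV fE) ≡ 𝟙 (extendsV fV) * pow2inv (nV G) * ∏ (λ e → edgeWeightAt fV e (fE e))
  weight-factorises fV fE = begin
    weight (total fV fE)
      ≡⟨ if-then-0≡𝟙* (sat ∧ (extendsV fV ∧ extE)) (pow2inv (nV G + numF τ)) ⟩
    𝟙 (sat ∧ (extendsV fV ∧ extE)) * pow2inv (nV G + numF τ)
      ≡⟨ cong₂ _*_ (trans (𝟙-∧ sat _) (cong (𝟙 sat *_) (𝟙-∧ (extendsV fV) extE)))
                   (pow2inv-+ (nV G) (numF τ)) ⟩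
    𝟙 sat * (𝟙 (extendsV fV) * 𝟙 extE) * (pow2inv (nV G) * pow2inv (numF τ))
      ≡⟨ cong (_* (pow2inv (nV G) * pow2inv (numF τ))) (x∙yz≈y∙xz (𝟙 sat) (𝟙 (extendsV fV)) (𝟙 extE)) ⟩
    𝟙 (extendsV fV) * (𝟙 sat * 𝟙 extE) * (pow2inv (nV G) * pow2inv (numF τ))
      ≡⟨ interchange (𝟙 (extendsV fV)) (𝟙 sat * 𝟙 extE) (pow2inv (nV G)) (pow2inv (numF τ)) ⟩
    𝟙 (extendsV fV) * pow2inv (nV G) * (𝟙 sat * 𝟙 extE * pow2inv (numF τ))
      ≡⟨ cong (𝟙 (extendsV fV) * pow2inv (nV G) *_) edges ⟩
    𝟙 (extendsV fV) * pow2inv (nV G) * ∏ (λ e → edgeWeightAt fV e (fE e)) ∎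
    where
    open ≡-Reasoning
    τ : Total G
    τ = total fV fE
    sat extE : Bool
    sat = satisfies τ
    extE = allFin (nE G) (λ e → agrees (SE S e) (fE e))
    clause agreement share : Fin (nE G) → ℚ
    clause e    = 𝟙 (fV (src G e) ∨ fE e ∨ fV (tgt G e))
    agreement e = 𝟙 (agrees (SE S e) (fE e))
    share e     = ½^ (fV (src G e) ∨ fV (tgt G e))
    edges : 𝟙 sat * 𝟙 extE * pow2inv (numF τ) ≡ ∏ (λ e → edgeWeightAt fV e (fE e))
    edges = begin
      𝟙 sat * 𝟙 extE * pow2inv (numF τ)
        ≡⟨ cong₂ _*_ (cong₂ _*_ (𝟙-allFin (nE G) _) (𝟙-allFin (nE G) _)) (pow2inv-countFin (nE G) _) ⟩
      ∏ clause * ∏ agreement * ∏ share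
        ≡⟨ cong (_* ∏ share) (∏-distrib-* clause agreement) ⟨
      ∏ (λ e → clause e * agreement e) * ∏ share
        ≡⟨ ∏-distrib-* (λ e → clause e * agreement e) share ⟨
      ∏ (λ e → edgeWeightAt fV e (fE e)) ∎

  module _ (guarded : Guarded S) (valid : Valid S) (fV : Fin (nV G) → Bool)
           (fV-extends : ∀ v → agrees (SV S v) (fV v) ≡ true) where

    edgeWeightAt-sum : ∀ e →
      edgeWeightAt fV e false ℚ.+ edgeWeightAt fV e true ≡ ½^ (is-just (SE S e) ∧ not (enforced S e))
    edgeWeightAt-sum e with SE S e in eSE
    ... | nothing = edgeWeight-nothing (fV (src G e)) (fV (tgt G e))
    ... | just b with guarded e b eSE
    ...   | (b₁ , p₁) , (b₂ , p₂)
      rewrite agrees-just p₁ (fV-extends (src G e))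
            | agrees-just p₂ (fV-extends (tgt G e))
            | enforced-just S e p₁ p₂
      = edgeWeight-just b₁ b₂ b (valid e b eSE ∘ trans (enforced-just S e p₁ p₂))

    ∏-edgeWeightAt-sum : ∏ (λ e → edgeWeightAt fV e false ℚ.+ edgeWeightAt fV e true)
                         ≡ pow2inv (numFreeAssignedEdges S)
    ∏-edgeWeightAt-sum = trans (∏-cong edgeWeightAt-sum) (sym (pow2inv-countFin (nE G) _))

  sum-weight-over-edges : Guarded S → Valid S → ∀ fV →
    sumℚ (map (λ fE → weight (total fV fE)) (allFns (nE G)))
      ≡ 𝟙 (extendsV fV) * pow2inv (nV G) * pow2inv (numFreeAssignedEdges S)
  sum-weight-over-edges guarded valid fV = begin
    sumℚ (map (λ fE → weight (total fV fE)) (allFns (nE G)))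
      ≡⟨ sumℚ-map-cong (weight-factorises fV) (allFns (nE G)) ⟩
    sumℚ (map (λ fE → c * ∏ (λ e → edgeWeightAt fV e (fE e))) (allFns (nE G)))
      ≡⟨ sumℚ-*ˡ c _ (allFns (nE G)) ⟩
    c * sumℚ (map (λ fE → ∏ (λ e → edgeWeightAt fV e (fE e))) (allFns (nE G)))
      ≡⟨ cong (c *_) (sumℚ-allFns-∏ (nE G) (edgeWeightAt fV)) ⟩
    c * ∏ (λ e → edgeWeightAt fV e false ℚ.+ edgeWeightAt fV e true)
      ≡⟨ 𝟙*-cong (extendsV fV) (pow2inv (nV G))
           (λ ext → ∏-edgeWeightAt-sum guarded valid fV (allFin⇒ (nV G) _ ext)) ⟩
    c * pow2inv (numFreeAssignedEdges S) ∎
    where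
    open ≡-Reasoning
    c : ℚ
    c = 𝟙 (extendsV fV) * pow2inv (nV G)

  sum-extendsV : pow2inv (nV G) * sumℚ (map (𝟙 ∘ extendsV) (allFns (nV G))) ≡ pow2inv (sizeSV S)
  sum-extendsV = begin
    pow2inv (nV G) * sumℚ (map (𝟙 ∘ extendsV) (allFns (nV G)))
      ≡⟨ cong₂ _*_ (pow2inv≡∏½ (nV G))
                   (trans (sumℚ-map-cong (λ fV → 𝟙-allFin (nV G) _) (allFns (nV G)))
                          (sumℚ-allFns-∏ (nV G) (λ v b → 𝟙 (agrees (SV S v) b)))) ⟩
    ∏ {nV G} (λ _ → ½) * ∏ agreements
      ≡⟨ ∏-distrib-* (λ _ → ½) agreements ⟨
    ∏ (λ v → ½ * agreements v)
      ≡⟨ ∏-cong (½*agreements ∘ SV S) ⟩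
    ∏ (½^_ ∘ is-just ∘ SV S)
      ≡⟨ pow2inv-countFin (nV G) (is-just ∘ SV S) ⟨
    pow2inv (sizeSV S) ∎
    where
    open ≡-Reasoning
    agreements : Fin (nV G) → ℚ
    agreements v = 𝟙 (agrees (SV S v) false) ℚ.+ 𝟙 (agrees (SV S v) true)

lemma3 : (G : Graph) → NoIsolatedVertices G → (S : Assignment G) →
    Guarded S → Valid S →
    PrExt S ≡ pow2inv (sizeSV S + numFreeAssignedEdges S)
lemma3 G _ S guarded valid = begin
  PrExt S
    ≡⟨ sumℚ-allTotals G (weight S) ⟩
  sumℚ (map (λ fV → sumℚ (map (λ fE → weight S (total fV fE)) (allFns (nE G)))) (allFns (nV G)))
    ≡⟨ sumℚ-map-cong (sum-weight-over-edges S guarded valid) (allFns (nV G)) ⟩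
  sumℚ (map (λ fV → 𝟙 (extendsV S fV) * p_V * p_F) (allFns (nV G)))
    ≡⟨ sumℚ-map-cong (λ fV → xy∙z≈yz∙x (𝟙 (extendsV S fV)) p_V p_F) (allFns (nV G)) ⟩
  sumℚ (map (λ fV → p_V * p_F * 𝟙 (extendsV S fV)) (allFns (nV G)))
    ≡⟨ sumℚ-*ˡ (p_V * p_F) (𝟙 ∘ extendsV S) (allFns (nV G)) ⟩
  p_V * p_F * sumℚ (map (𝟙 ∘ extendsV S) (allFns (nV G)))
    ≡⟨ xy∙z≈xz∙y p_V p_F _ ⟩
  p_V * sumℚ (map (𝟙 ∘ extendsV S) (allFns (nV G))) * p_F
    ≡⟨ cong (_* p_F) (sum-extendsV S) ⟩
  pow2inv (sizeSV S) * p_F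
    ≡⟨ pow2inv-+ (sizeSV S) (numFreeAssignedEdges S) ⟨
  pow2inv (sizeSV S + numFreeAssignedEdges S) ∎
  where
  open ≡-Reasoning
  p_V p_F : ℚ
  p_V = pow2inv (nV G)
  p_F = pow2inv (numFreeAssignedEdges S)
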